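{- Let $t<n/3$. Consider the one-round protocol WC on $n$ processors in which each $p_i$ with input bit $x_i$ sends $x_i$ to every $p_j$; $p_j$ lets $P_j^0$ (resp. $P_j^1$) be the set of processors from which it received $0$ (resp. $1$), and sets $y_j:=0$ if $|P_j^0|>2n/3$, else $y_j:=1$ if $|P_j^1|>2n/3$, else $y_j:=\bot$. Against an eventually-stationary mobile Byzantine $t$-MAd adversary, WC satisfies: (weak consistency) there is $y\in\{0,1\}$ such that every $p_j$ sets $y_j\in\{y,\bot\}$; (persistency) if every processor has the same input $x$ then every $p_j$ sets $y_j=x$; (termination) every processor sets its value $y_j$ after a single round.
   Context: System: $n$ processors run a synchronous round-based protocol; each round every processor sends a (possibly different) message to every processor over dedicated point-to-point channels whose receiver knows the sender identity; messages of round $\rho$ are delivered by the start of round $\rho+1$. A message adversary (MAd) sees all messages; in the Byzantine type it may delete or arbitrarily replace any outgoing message, in a given round, of the processors it corrupts in that round; it never alters internal states, inputs, outputs or incoming messages. A mobile $t$-MAd adversary corrupts at most $t$ processors per round, possibly different each round; an eventually-stationary mobile $t$-MAd adversary behaves as a mobile $t$-MAd adversary for a finite, unknown number of rounds and thereafter confines its corruptions to a fixed set of at most $t$ processors. All guarantees apply to all processors, corrupted or not. -}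

module Defs where

open import Data.Nat using (ℕ; _*_; _<?_)
open import Data.Bool using (Bool; true; false; if_then_else_)
open import Data.Maybe using (Maybe; just; nothing)
open import Data.Maybe.Properties using (≡-dec)
open import Data.Bool.Properties using () renaming (_≟_ to _≟B_)
open import Data.Fin using (Fin)
open import Data.Fin.Subset using (Subset; inside; ∣_∣)
open import Data.Vec using (tabulate; lookup)
open import Relation.Nullary using (does)

-- A message received over a channel in round 1: a bit, or nothing
-- (deleted / non-bit garbage, which is counted in neither P⁰ nor P¹).
Msg : Set
Msg = Maybe Bool

-- C   : the set of processors corrupted by the adversary in round 1.
-- adv : for a corrupted sender i, adv i j is what the adversary makes
--       p_j receive from p_i (just b = replaced/kept bit b, nothing = deleted).
received : ∀ {n} → (Fin n → Bool) → Subset n → (Fin n → Fin n → Msg)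
         → Fin n → Fin n → Msg
received x C adv i j with lookup C i
... | inside = adv i j
... | _      = just (x i)

P : ∀ {n} → (Fin n → Fin n → Msg) → Fin n → Bool → Subset n
P recv j b = tabulate (λ i → does (≡-dec _≟B_ (recv i j) (just b)))

-- Output of p_j (nothing = ⊥):  0 if |P⁰| > 2n/3, else 1 if |P¹| > 2n/3, else ⊥.
-- |P| > 2n/3 is written  2n < 3|P|.
WC : ∀ {n} → (Fin n → Bool) → Subset n → (Fin n → Fin n → Msg) → Fin n → Maybe Bool
WC {n} x C adv j =
  if does (2 * n <? 3 * ∣ P (received x C adv) j false ∣) then just false
  else if does (2 * n <? 3 * ∣ P (received x C adv) j true ∣) then just true
  else nothing

-- Honest senders deliver their input bit to everybody, so a processor can be
-- counted in P⁰ of one receiver and in P¹ of another only if it is corrupted.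
-- By inclusion–exclusion |P_j⁰| + |P_k¹| ≤ n + t, while two supermajorities
-- would need more than 4n/3; as 3t < n this rules out opposite decisions.  When
-- all inputs equal v, the ≥ n − t honest processors put more than 2n/3 votes
-- into P_j^v and at most t < n/3 go to the other bit.
module Submission where

open import Defs
open import Data.Nat using (ℕ; suc; _*_; _+_; _<_; _≤_; _≮_; _<ᵇ_; _<?_)
open import Data.Nat.Properties
open import Data.Nat.Tactic.RingSolver using (solve)
open import Data.Bool using (Bool; true; false; not; if_then_else_)
open import Data.Bool.Properties using (not-¬; ¬-not) renaming (_≟_ to _≟B_)
open import Data.Maybe using (Maybe; just; nothing)
open import Data.Maybe.Properties using (≡-dec; just-injective)
open import Data.Fin using (Fin)
open import Data.Fin.Properties using (any?)
open import Data.Fin.Subset using (Subset; ∣_∣; inside; outside; _∈_; _∉_; _⊆_; _∪_; _∩_; ⊤)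
open import Data.Fin.Subset.Properties
  using (_∈?_; x∈p∩q⁻; x∈p∪q⁺; p⊆q⇒∣p∣≤∣q∣; ∣⊤∣≡n; ∣p∣≤n)
import Data.List as List
open import Data.Vec using (_∷_; []; lookup)
open import Data.Vec.Properties using (lookup∘tabulate; lookup⇒[]=; []=⇒lookup)
open import Data.Product using (_×_; ∃-syntax; _,_)
open import Data.Sum using (_⊎_; inj₁; inj₂)
open import Data.Empty using (⊥)
open import Relation.Nullary using (does; yes; no; contradiction)
open import Relation.Nullary.Reflects using (ofʸ; ofⁿ)
open import Relation.Nullary.Decidable using (dec-true)
open import Relation.Binary.PropositionalEquality

∣p∪q∣+∣p∩q∣≡∣p∣+∣q∣ : ∀ {n} (p q : Subset n) → ∣ p ∪ q ∣ + ∣ p ∩ q ∣ ≡ ∣ p ∣ + ∣ q ∣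
∣p∪q∣+∣p∩q∣≡∣p∣+∣q∣ []            []            = refl
∣p∪q∣+∣p∩q∣≡∣p∣+∣q∣ (outside ∷ p) (outside ∷ q) = ∣p∪q∣+∣p∩q∣≡∣p∣+∣q∣ p q
∣p∪q∣+∣p∩q∣≡∣p∣+∣q∣ (inside  ∷ p) (inside  ∷ q) =
  cong suc (trans (+-suc _ _) (trans (cong suc (∣p∪q∣+∣p∩q∣≡∣p∣+∣q∣ p q)) (sym (+-suc _ _))))
∣p∪q∣+∣p∩q∣≡∣p∣+∣q∣ (inside  ∷ p) (outside ∷ q) = cong suc (∣p∪q∣+∣p∩q∣≡∣p∣+∣q∣ p q)
∣p∪q∣+∣p∩q∣≡∣p∣+∣q∣ (outside ∷ p) (inside  ∷ q) =
  trans (cong suc (∣p∪q∣+∣p∩q∣≡∣p∣+∣q∣ p q)) (sym (+-suc _ _))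

∣p∪q∣≤∣p∣+∣q∣ : ∀ {n} (p q : Subset n) → ∣ p ∪ q ∣ ≤ ∣ p ∣ + ∣ q ∣
∣p∪q∣≤∣p∣+∣q∣ p q = ≤-trans (m≤m+n _ _) (≤-reflexive (∣p∪q∣+∣p∩q∣≡∣p∣+∣q∣ p q))

∣p∣+∣q∣≤n+∣p∩q∣ : ∀ {n} (p q : Subset n) → ∣ p ∣ + ∣ q ∣ ≤ n + ∣ p ∩ q ∣
∣p∣+∣q∣≤n+∣p∩q∣ p q =
  ≤-trans (≤-reflexive (sym (∣p∪q∣+∣p∩q∣≡∣p∣+∣q∣ p q))) (+-monoˡ-≤ _ (∣p∣≤n (p ∪ q)))

module _ {n : ℕ} (recv : Fin n → Fin n → Msg) {j : Fin n} {b : Bool} {i : Fin n} where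

  ∈P⁺ : recv i j ≡ just b → i ∈ P recv j b
  ∈P⁺ eq =
    lookup⇒[]= i _ (trans (lookup∘tabulate _ i) (dec-true (≡-dec _≟B_ (recv i j) (just b)) eq))

  ∈P⁻ : i ∈ P recv j b → recv i j ≡ just b
  ∈P⁻ i∈P with ≡-dec _≟B_ (recv i j) (just b) | trans (sym (lookup∘tabulate _ i)) ([]=⇒lookup i∈P)
  ... | yes eq | _  = eq
  ... | no _   | ()

module _ {n : ℕ} (x : Fin n → Bool) (C : Subset n) (adv : Fin n → Fin n → Msg) where

  votes : Fin n → Bool → Subset n
  votes = P (received x C adv)

  honest-delivers : ∀ {i j} → i ∉ C → received x C adv i j ≡ just (x i)
  honest-delivers {i} i∉C with lookup C i in eq
  ... | inside  = contradiction (lookup⇒[]= i C eq) i∉C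
  ... | outside = refl

  honest-∈votes : ∀ {i j} → i ∉ C → i ∈ votes j (x i)
  honest-∈votes i∉C = ∈P⁺ (received x C adv) (honest-delivers i∉C)

  misreported⇒corrupted : ∀ {i j b} → i ∈ votes j b → x i ≢ b → i ∈ C
  misreported⇒corrupted {i} i∈P xi≢b with i ∈? C
  ... | yes i∈C = i∈C
  ... | no  i∉C =
    contradiction (just-injective (trans (sym (honest-delivers i∉C)) (∈P⁻ (received x C adv) i∈P))) xi≢b

  votes⁰∩votes¹⊆C : ∀ j k → votes j false ∩ votes k true ⊆ C
  votes⁰∩votes¹⊆C j k {i} i∈∩ with x∈p∩q⁻ (votes j false) (votes k true) i∈∩ | x i in xi
  ... | _   , i∈¹ | false = misreported⇒corrupted i∈¹ λ xi≡true  → contradiction (trans (sym xi) xi≡true) λ ()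
  ... | i∈⁰ , _   | true  = misreported⇒corrupted i∈⁰ λ xi≡false → contradiction (trans (sym xi) xi≡false) λ ()

  ∣votes⁰∣+∣votes¹∣≤n+∣C∣ : ∀ j k → ∣ votes j false ∣ + ∣ votes k true ∣ ≤ n + ∣ C ∣
  ∣votes⁰∣+∣votes¹∣≤n+∣C∣ j k =
    ≤-trans (∣p∣+∣q∣≤n+∣p∩q∣ (votes j false) (votes k true)) (+-monoʳ-≤ n (p⊆q⇒∣p∣≤∣q∣ (votes⁰∩votes¹⊆C j k)))

  module _ {v : Bool} (unanimous : ∀ i → x i ≡ v) (j : Fin n) where

    ⊤⊆votesᵛ∪C : ⊤ ⊆ votes j v ∪ C
    ⊤⊆votesᵛ∪C {i} _ with i ∈? C
    ... | yes i∈C = x∈p∪q⁺ (inj₂ i∈C)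
    ... | no  i∉C = x∈p∪q⁺ (inj₁ (subst (λ b → i ∈ votes j b) (unanimous i) (honest-∈votes i∉C)))

    votes¬ᵛ⊆C : votes j (not v) ⊆ C
    votes¬ᵛ⊆C {i} i∈P = misreported⇒corrupted i∈P (not-¬ (unanimous i))

    n≤∣votesᵛ∣+∣C∣ : n ≤ ∣ votes j v ∣ + ∣ C ∣
    n≤∣votesᵛ∣+∣C∣ = begin
      n                      ≡⟨ sym (∣⊤∣≡n n) ⟩
      ∣ ⊤ {n} ∣              ≤⟨ p⊆q⇒∣p∣≤∣q∣ ⊤⊆votesᵛ∪C ⟩
      ∣ votes j v ∪ C ∣      ≤⟨ ∣p∪q∣≤∣p∣+∣q∣ (votes j v) C ⟩
      ∣ votes j v ∣ + ∣ C ∣  ∎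
      where open ≤-Reasoning

    ∣votes¬ᵛ∣≤∣C∣ : ∣ votes j (not v) ∣ ≤ ∣ C ∣
    ∣votes¬ᵛ∣≤∣C∣ = p⊆q⇒∣p∣≤∣q∣ votes¬ᵛ⊆C

-- WC x C adv j is definitionally decide n ∣ votes x C adv j false ∣ ∣ votes x C adv j true ∣.
decide : ℕ → ℕ → ℕ → Maybe Bool
decide n a₀ a₁ =
  if does (2 * n <? 3 * a₀) then just false
  else if does (2 * n <? 3 * a₁) then just true
  else nothing

decide≡just-false⇒ : ∀ n a₀ a₁ → decide n a₀ a₁ ≡ just false → 2 * n < 3 * a₀
decide≡just-false⇒ n a₀ a₁ eq with 2 * n <ᵇ 3 * a₀ | <ᵇ-reflects-< (2 * n) (3 * a₀) | 2 * n <ᵇ 3 * a₁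
... | true  | ofʸ p | _     = p
... | false | _     | true  = contradiction eq λ ()
... | false | _     | false = contradiction eq λ ()

decide≡just-true⇒ : ∀ n a₀ a₁ → decide n a₀ a₁ ≡ just true → 2 * n < 3 * a₁
decide≡just-true⇒ n a₀ a₁ eq with 2 * n <ᵇ 3 * a₀ | 2 * n <ᵇ 3 * a₁ | <ᵇ-reflects-< (2 * n) (3 * a₁)
... | true  | _     | _     = contradiction eq λ ()
... | false | true  | ofʸ p = p
... | false | false | _     = contradiction eq λ ()

decide-false : ∀ n a₀ a₁ → 2 * n < 3 * a₀ → decide n a₀ a₁ ≡ just false
decide-false n a₀ a₁ p with 2 * n <ᵇ 3 * a₀ | <ᵇ-reflects-< (2 * n) (3 * a₀)
... | true  | _      = refl
... | false | ofⁿ ¬p = contradiction p ¬p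

decide-true : ∀ n a₀ a₁ → 2 * n ≮ 3 * a₀ → 2 * n < 3 * a₁ → decide n a₀ a₁ ≡ just true
decide-true n a₀ a₁ ¬p q
  with 2 * n <ᵇ 3 * a₀ | <ᵇ-reflects-< (2 * n) (3 * a₀) | 2 * n <ᵇ 3 * a₁ | <ᵇ-reflects-< (2 * n) (3 * a₁)
... | true  | ofʸ p | _     | _      = contradiction p ¬p
... | false | _     | true  | _      = refl
... | false | _     | false | ofⁿ ¬q = contradiction q ¬q

module _ {n t : ℕ} (3t<n : 3 * t < n) where

  n≤a+t⇒2n<3a : ∀ {a} → n ≤ a + t → 2 * n < 3 * a
  n≤a+t⇒2n<3a {a} n≤a+t = +-cancelʳ-< n (2 * n) (3 * a) (begin-strict
    2 * n + n      ≡⟨ +-comm (2 * n) n ⟩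
    3 * n          ≤⟨ *-monoʳ-≤ 3 n≤a+t ⟩
    3 * (a + t)    ≡⟨ *-distribˡ-+ 3 a t ⟩
    3 * a + 3 * t  <⟨ +-monoʳ-< (3 * a) 3t<n ⟩
    3 * a + n      ∎)
    where open ≤-Reasoning

  a≤t⇒2n≮3a : ∀ {a} → a ≤ t → 2 * n ≮ 3 * a
  a≤t⇒2n≮3a {a} a≤t 2n<3a = <-irrefl refl (begin-strict
    2 * n  <⟨ 2n<3a ⟩
    3 * a  ≤⟨ *-monoʳ-≤ 3 a≤t ⟩
    3 * t  <⟨ 3t<n ⟩
    n      ≤⟨ m≤n*m n 2 ⟩
    2 * n  ∎)
    where open ≤-Reasoning

  a+b≤n+t⇒¬[2n<3a×2n<3b] : ∀ {a b} → a + b ≤ n + t → 2 * n < 3 * a → 2 * n < 3 * b → ⊥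
  a+b≤n+t⇒¬[2n<3a×2n<3b] {a} {b} a+b≤n+t 2n<3a 2n<3b = <-irrefl refl (begin-strict
    3 * n + n      ≡⟨ solve (n List.∷ List.[]) ⟩
    2 * n + 2 * n  <⟨ +-mono-< 2n<3a 2n<3b ⟩
    3 * a + 3 * b  ≡⟨ *-distribˡ-+ 3 a b ⟨
    3 * (a + b)    ≤⟨ *-monoʳ-≤ 3 a+b≤n+t ⟩
    3 * (n + t)    ≡⟨ *-distribˡ-+ 3 n t ⟩
    3 * n + 3 * t  <⟨ +-monoʳ-< (3 * n) 3t<n ⟩
    3 * n + n      ∎)
    where open ≤-Reasoning

≢just-not⇒≡just-or-nothing : ∀ {v} (r : Maybe Bool) → r ≢ just (not v) → (r ≡ just v) ⊎ (r ≡ nothing)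
≢just-not⇒≡just-or-nothing nothing _ = inj₂ refl
≢just-not⇒≡just-or-nothing {v} (just b) r≢just-not-v with b ≟B v
... | yes refl = inj₁ refl
... | no b≢v   = contradiction (cong just (¬-not b≢v)) r≢just-not-v

no-conflict⇒agreement : ∀ {m} (y : Fin m → Maybe Bool) →
  (∀ j k → y j ≡ just false → y k ≡ just true → ⊥) →
  ∃[ v ] (∀ j → (y j ≡ just v) ⊎ (y j ≡ nothing))
no-conflict⇒agreement y conflict with any? (λ j → ≡-dec _≟B_ (y j) (just false))
... | yes (j , yj≡0) = false , λ k → ≢just-not⇒≡just-or-nothing (y k) (conflict j k yj≡0)
... | no ¬any        = true  , λ k → ≢just-not⇒≡just-or-nothing (y k) (λ yk≡0 → ¬any (k , yk≡0))

theorem5p2 : (n t : ℕ) → 3 * t < n →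
    (x : Fin n → Bool) → (C : Subset n) → ∣ C ∣ ≤ t →
    (adv : Fin n → Fin n → Msg) →
    (∃[ y ] (∀ j → (WC x C adv j ≡ just y) ⊎ (WC x C adv j ≡ nothing)))
    × (∀ v → (∀ i → x i ≡ v) → ∀ j → WC x C adv j ≡ just v)
theorem5p2 n t 3t<n x C ∣C∣≤t adv = weak-consistency , persistency
  where
  ∣votes_∣ : Bool → Fin n → ℕ
  ∣votes b ∣ j = ∣ votes x C adv j b ∣

  weak-consistency : ∃[ y ] (∀ j → (WC x C adv j ≡ just y) ⊎ (WC x C adv j ≡ nothing))
  weak-consistency = no-conflict⇒agreement (WC x C adv) λ j k WCj≡0 WCk≡1 →
    a+b≤n+t⇒¬[2n<3a×2n<3b] 3t<n {∣votes false ∣ j} {∣votes true ∣ k}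
      (≤-trans (∣votes⁰∣+∣votes¹∣≤n+∣C∣ x C adv j k) (+-monoʳ-≤ n ∣C∣≤t))
      (decide≡just-false⇒ n (∣votes false ∣ j) (∣votes true ∣ j) WCj≡0)
      (decide≡just-true⇒ n (∣votes false ∣ k) (∣votes true ∣ k) WCk≡1)

  supermajority : ∀ {v} → (∀ i → x i ≡ v) → ∀ j → 2 * n < 3 * ∣votes v ∣ j
  supermajority {v} unanimous j =
    n≤a+t⇒2n<3a 3t<n {∣votes v ∣ j}
      (≤-trans (n≤∣votesᵛ∣+∣C∣ x C adv unanimous j) (+-monoʳ-≤ (∣votes v ∣ j) ∣C∣≤t))

  persistency : ∀ v → (∀ i → x i ≡ v) → ∀ j → WC x C adv j ≡ just v
  persistency false unanimous j =
    decide-false n (∣votes false ∣ j) (∣votes true ∣ j) (supermajority unanimous j)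
  persistency true  unanimous j =
    decide-true n (∣votes false ∣ j) (∣votes true ∣ j)
      (a≤t⇒2n≮3a 3t<n (≤-trans (∣votes¬ᵛ∣≤∣C∣ x C adv unanimous j) ∣C∣≤t))
      (supermajority unanimous j)
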